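{- For all $n\ge 3$, $r'(n)=r(n+1)$ and $u'(n)=u(n+1)$.
   Context: $RP(n)$: set of rooted phylogenies over $[n]$ (rooted trees with leaf set $[n]$, internal nodes with at least two children; resolved if exactly two). $P(m)$: set of unrooted phylogenies over $[m]$ (unrooted trees with leaf set $[m]$, internal nodes of degree at least $3$; resolved if degree $3$). A triplet (quartet) $X$ is resolved in $T$ if the restriction $T|X$ (minimal subtree spanning $X$ with degree-two nodes suppressed, except the root in the rooted case) is fully resolved. $r'(n)$: probability that a given fixed triplet over $[n]$ is resolved in a uniformly random tree from $RP(n)$; $u'(n)=1-r'(n)$. $r(m)$: probability that a given fixed quartet over $[m]$ is resolved in a uniformly random tree from $P(m)$; $u(m)=1-r(m)$. -}

module Defs where

open import Data.Bool using (Bool; true; false; _∧_; _∨_; not)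
open import Data.Nat using (ℕ; zero; suc; _*_; _∸_; _≡ᵇ_)
open import Data.Integer using (+_)
open import Data.Rational using (ℚ; _/_; 0ℚ; 1ℚ; _-_)
open import Data.List using (List; []; _∷_; [_]; map; _++_; filterᵇ; length)
open import Data.Bool.ListAction using (all; any)
open import Data.Vec using (Vec; []; _∷_)
open import Data.Fin using (Fin)
open import Data.Fin.Subset using (Subset; _∩_; _∪_; ∁; ⁅_⁆; ⊤; ∣_∣)

allSubsets : (n : ℕ) → List (Subset n)
allSubsets zero = [ [] ]
allSubsets (suc n) = map (true ∷_) (allSubsets n) ++ map (false ∷_) (allSubsets n)

-- all sub-lists (= all subfamilies, each exactly once, of a duplicate-free list)
sublists : {A : Set} → List A → List (List A)
sublists [] = [ [] ]
sublists (x ∷ xs) = map (x ∷_) (sublists xs) ++ sublists xs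

allFins : (n : ℕ) → List (Fin n)
allFins zero = []
allFins (suc n) = Fin.zero ∷ map Fin.suc (allFins n)

countᵇ : {A : Set} → (A → Bool) → List A → ℕ
countᵇ p xs = length (filterᵇ p xs)

eqᵇ : {n : ℕ} → Subset n → Subset n → Bool
eqᵇ [] [] = true
eqᵇ (true ∷ a) (true ∷ b) = eqᵇ a b
eqᵇ (false ∷ a) (false ∷ b) = eqᵇ a b
eqᵇ (_ ∷ _) (_ ∷ _) = false

isEmptyᵇ : {n : ℕ} → Subset n → Bool
isEmptyᵇ [] = true
isEmptyᵇ (true ∷ a) = false
isEmptyᵇ (false ∷ a) = isEmptyᵇ a

subᵇ : {n : ℕ} → Subset n → Subset n → Bool
subᵇ A B = eqᵇ (A ∩ B) A

memᵇ : {n : ℕ} → Subset n → List (Subset n) → Bool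
memᵇ A F = any (eqᵇ A) F

-- Rooted phylogenies over [n], encoded by their cluster systems
-- (hierarchies): the set of leaf-sets below the nodes. A family H of
-- subsets of [n] is the cluster system of a rooted phylogeny iff it
-- contains [n] and every singleton, contains no empty set, and any two
-- clusters are nested or disjoint.

isHierarchy : {n : ℕ} → List (Subset n) → Bool
isHierarchy {n} H =
  memᵇ ⊤ H ∧ all (λ i → memᵇ ⁅ i ⁆ H) (allFins n) ∧
  all (λ A → not (isEmptyᵇ A)) H ∧
  all (λ A → all (λ B → isEmptyᵇ (A ∩ B) ∨ subᵇ A B ∨ subᵇ B A) H) H

RP : (n : ℕ) → List (List (Subset n))
RP n = filterᵇ isHierarchy (sublists (allSubsets n))

-- number of distinct clusters of the restriction T|X,
-- i.e. of the distinct nonempty sets A ∩ X with A a cluster of T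
restrictedClusters : {n : ℕ} → List (Subset n) → Subset n → ℕ
restrictedClusters {n} H X =
  countᵇ (λ S → not (isEmptyᵇ S) ∧ any (λ A → eqᵇ (A ∩ X) S) H) (allSubsets n)

-- T|X is fully resolved (binary) iff it has 2|X| - 1 clusters (nodes)
rootedResolvedᵇ : {n : ℕ} → Subset n → List (Subset n) → Bool
rootedResolvedᵇ X H = restrictedClusters H X ≡ᵇ (2 * ∣ X ∣ ∸ 1)

-- Unrooted phylogenies over [m], encoded by their split systems: the
-- family F of all sides of the edge-splits A | ∁A (both sides listed).
-- F encodes an unrooted phylogeny iff it is closed under complement,
-- contains no empty or full set, contains every singleton (pendant
-- edges), and any two sides A, B are compatible
-- (A ∩ B = ∅, A ⊆ B, B ⊆ A, or A ∪ B = [m]).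

isSplitSystem : {m : ℕ} → List (Subset m) → Bool
isSplitSystem {m} F =
  all (λ A → memᵇ (∁ A) F) F ∧
  all (λ A → not (isEmptyᵇ A) ∧ not (eqᵇ A ⊤)) F ∧
  all (λ i → memᵇ ⁅ i ⁆ F) (allFins m) ∧
  all (λ A → all (λ B → isEmptyᵇ (A ∩ B) ∨ subᵇ A B ∨ subᵇ B A ∨ eqᵇ (A ∪ B) ⊤) F) F

P : (m : ℕ) → List (List (Subset m))
P m = filterᵇ isSplitSystem (sublists (allSubsets m))

-- number of distinct split sides of T|Y: distinct sets A ∩ Y, A a side
-- of a split of T, with both A ∩ Y and ∁A ∩ Y nonempty
restrictedSides : {m : ℕ} → List (Subset m) → Subset m → ℕ
restrictedSides {m} F Y =
  countᵇ (λ S → not (isEmptyᵇ S) ∧ not (eqᵇ S Y) ∧ any (λ A → eqᵇ (A ∩ Y) S) F)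
         (allSubsets m)

-- T|Y is fully resolved iff it has 2|Y| - 3 splits, i.e. 2(2|Y| - 3) sides
unrootedResolvedᵇ : {m : ℕ} → Subset m → List (Subset m) → Bool
unrootedResolvedᵇ Y F = restrictedSides F Y ≡ᵇ (2 * (2 * ∣ Y ∣ ∸ 3))

ratio : ℕ → ℕ → ℚ
ratio a zero = 0ℚ
ratio a (suc b) = (+ a) / suc b

r′ : (n : ℕ) → Subset n → ℚ
r′ n X = ratio (countᵇ (rootedResolvedᵇ X) (RP n)) (length (RP n))

u′ : (n : ℕ) → Subset n → ℚ
u′ n X = 1ℚ - r′ n X

r : (m : ℕ) → Subset m → ℚ
r m Y = ratio (countᵇ (unrootedResolvedᵇ Y) (P m)) (length (P m))

u : (m : ℕ) → Subset m → ℚ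
u m Y = 1ℚ - r m Y

module Submission where

-- Attaching a new leaf 0 at the root turns a rooted phylogeny over [n] into an unrooted phylogeny over
-- [n + 1], bijectively: a cluster A becomes the split A | {0} ∪ ([n] ∖ A). Restricted to X ∪ {0}, every
-- cluster of T|X yields the two sides of one split, so T|X is resolved (2|X| - 1 clusters) exactly when
-- the unrooted tree restricted to X ∪ {0} is resolved (2(2(|X| + 1) - 3) sides). Hence r'(n) is the
-- probability that the quartet X ∪ {0} is resolved; and since relabelling the leaves by an involution
-- permutes the unrooted phylogenies, while involutions carry any quartet to any other, that probability
-- does not depend on the quartet.

open import Defs
open import Data.Nat using (ℕ; suc; _≤_)
open import Data.Product using (_×_)
open import Data.Fin.Subset using (Subset; ∣_∣)
open import Relation.Binary.PropositionalEquality using (_≡_)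

import Algebra.Definitions as Algebra
import Algebra.Lattice.Properties.BooleanAlgebra as BooleanAlgebra
open import Data.Bool using (Bool; true; false; _∧_; _∨_; not; T?; _xor_)
open import Data.Bool.Properties
  using (⇔→≡; T-≡; ∧-conicalˡ; ∧-conicalʳ; ∧-idem; ∧-identityʳ; ∧-assoc; ∧-comm; ∨-identityʳ; ∨-zeroʳ;
         ∨-assoc; ∨-comm; ∨-∧-booleanAlgebra; xor-assoc; xor-same; xor-identityʳ)
open import Data.Bool.ListAction using (all; any)
open import Data.Nat using (zero; _+_; _*_; _∸_; _≡ᵇ_)
open import Data.Nat.Properties using (+-suc; *-suc; +-identityʳ; suc-injective)
open import Data.Fin using (Fin; zero; suc; _≟_)
import Data.Fin.Properties as Fin
open import Data.Fin.Subset using (_∩_; _∪_; ∁; ⁅_⁆; ⊤; ⊥)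
open import Data.Fin.Subset.Properties using (∩-comm; ∪-∩-booleanAlgebra)
open import Data.Vec using ([]; _∷_; zipWith; lookup; tabulate; replicate)
open import Data.Vec.Properties
  using (lookup∘tabulate; tabulate∘lookup; tabulate-cong; lookup-zipWith; lookup-map; lookup-replicate)
import Data.Vec.Properties as Vec
open import Data.List using (List; []; _∷_; map; _++_; filterᵇ; length)
open import Data.List.Properties using (length-map; ∷-injectiveʳ)
open import Data.List.Membership.Propositional using (_∈_)
open import Data.List.Membership.Propositional.Properties
  using (∈-filter⁺; ∈-filter⁻; ∈-map⁺; ∈-map⁻; ∈-++⁺ˡ; ∈-++⁺ʳ; ∈-++⁻)
open import Data.List.Membership.Propositional.Properties.WithK using (unique∧set⇒bag)
open import Data.List.Relation.Binary.BagAndSetEquality using (∼bag⇒↭)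
open import Data.List.Relation.Binary.Permutation.Propositional.Properties using (↭-length)
open import Data.List.Relation.Unary.Any using (here; there)
open import Data.List.Relation.Unary.All using (All; []; _∷_) renaming (lookup to All-lookup)
open import Data.List.Relation.Unary.AllPairs using ([]; _∷_)
open import Data.List.Relation.Unary.Unique.Propositional using (Unique)
import Data.List.Relation.Unary.Unique.Propositional.Properties as Unique
open import Data.Product using (∃; _,_; proj₁; proj₂)
open import Data.Rational using (1ℚ; _-_)
open import Data.Sum using (_⊎_; inj₁; inj₂)
open import Data.Empty using (⊥-elim)
open import Function using (_∘_; Equivalence)
open import Function.Bundles using (mk⇔)
open import Relation.Nullary using (¬_; yes; no)
open import Relation.Binary.PropositionalEquality using (refl; sym; trans; cong; cong₂; subst; module ≡-Reasoning)

private variable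
  A B : Set
  n : ℕ

private module SubsetAlgebra {n : ℕ} = BooleanAlgebra (∪-∩-booleanAlgebra n)
private module BoolAlgebra = BooleanAlgebra ∨-∧-booleanAlgebra

≡true-ext : {b c : Bool} → (b ≡ true → c ≡ true) → (c ≡ true → b ≡ true) → b ≡ c
≡true-ext f g = ⇔→≡ (mk⇔ f g)

∨≡true⁻ : (b : Bool) {c : Bool} → b ∨ c ≡ true → b ≡ true ⊎ c ≡ true
∨≡true⁻ true  _ = inj₁ refl
∨≡true⁻ false e = inj₂ e

all⁻ : (p : A → Bool) {xs : List A} → all p xs ≡ true → ∀ {x} → x ∈ xs → p x ≡ true
all⁻ p {y ∷ _} e (here refl) = ∧-conicalˡ _ _ e
all⁻ p {y ∷ _} e (there x∈xs) = all⁻ p (∧-conicalʳ (p y) _ e) x∈xs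

all⁺ : (p : A → Bool) {xs : List A} → (∀ {x} → x ∈ xs → p x ≡ true) → all p xs ≡ true
all⁺ p {[]} _ = refl
all⁺ p {y ∷ _} h = cong₂ _∧_ (h (here refl)) (all⁺ p (h ∘ there))

all-cong : {p q : A → Bool} (xs : List A) → (∀ x → p x ≡ q x) → all p xs ≡ all q xs
all-cong [] _ = refl
all-cong (x ∷ xs) p≗q = cong₂ _∧_ (p≗q x) (all-cong xs p≗q)

any-cong : {p q : A → Bool} (xs : List A) → (∀ x → p x ≡ q x) → any p xs ≡ any q xs
any-cong [] _ = refl
any-cong (x ∷ xs) p≗q = cong₂ _∨_ (p≗q x) (any-cong xs p≗q)

all-map : (p : B → Bool) (f : A → B) (xs : List A) → all p (map f xs) ≡ all (p ∘ f) xs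
all-map p f [] = refl
all-map p f (x ∷ xs) = cong (p (f x) ∧_) (all-map p f xs)

any≡not-all-not : (p : A → Bool) (xs : List A) → any p xs ≡ not (all (not ∘ p) xs)
any≡not-all-not p [] = refl
any≡not-all-not p (x ∷ xs) with p x
... | true  = refl
... | false = any≡not-all-not p xs

all-image₂ : (p : B → Bool) (f g : A → B) (xs : List A) (ys : List B) →
  (∀ {y} → y ∈ ys → ∃ λ x → x ∈ xs × (y ≡ f x ⊎ y ≡ g x)) →
  (∀ {x} → x ∈ xs → f x ∈ ys × g x ∈ ys) →
  all p ys ≡ all (λ x → p (f x) ∧ p (g x)) xs
all-image₂ {A = A} p f g xs ys onto into = ≡true-ext
  (λ all-ys → all⁺ p₂ λ x∈xs →
    cong₂ _∧_ (all⁻ p all-ys (proj₁ (into x∈xs))) (all⁻ p all-ys (proj₂ (into x∈xs))))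
  (λ all-xs → all⁺ p λ y∈ys → from-preimage all-xs (onto y∈ys))
  where
  p₂ : A → Bool
  p₂ x = p (f x) ∧ p (g x)
  from-preimage : ∀ {y} → all p₂ xs ≡ true → (∃ λ x → x ∈ xs × (y ≡ f x ⊎ y ≡ g x)) → p y ≡ true
  from-preimage all-xs (x , x∈xs , inj₁ refl) = ∧-conicalˡ _ _ (all⁻ p₂ all-xs x∈xs)
  from-preimage all-xs (x , x∈xs , inj₂ refl) = ∧-conicalʳ (p (f x)) _ (all⁻ p₂ all-xs x∈xs)

all-image : (p : B → Bool) (f : A → B) (xs : List A) (ys : List B) →
  (∀ {y} → y ∈ ys → ∃ λ x → x ∈ xs × y ≡ f x) →
  (∀ {x} → x ∈ xs → f x ∈ ys) →
  all p ys ≡ all (p ∘ f) xs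
all-image p f xs ys onto into = trans
  (all-image₂ p f f xs ys (onto₂ ∘ onto) (λ x∈xs → into x∈xs , into x∈xs))
  (all-cong xs (λ x → ∧-idem (p (f x))))
  where
  onto₂ : ∀ {y} → (∃ λ x → x ∈ xs × y ≡ f x) → ∃ λ x → x ∈ xs × (y ≡ f x ⊎ y ≡ f x)
  onto₂ (x , x∈xs , y≡fx) = x , x∈xs , inj₁ y≡fx

countᵇ-cong : {p q : A → Bool} (xs : List A) → (∀ x → p x ≡ q x) → countᵇ p xs ≡ countᵇ q xs
countᵇ-cong {p = p} {q} (x ∷ xs) p≗q with p x | q x | p≗q x
... | true  | true  | refl = cong suc (countᵇ-cong xs p≗q)
... | false | false | refl = countᵇ-cong xs p≗q
countᵇ-cong [] _ = refl

countᵇ-++ : (p : A → Bool) (xs ys : List A) → countᵇ p (xs ++ ys) ≡ countᵇ p xs + countᵇ p ys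
countᵇ-++ p [] ys = refl
countᵇ-++ p (x ∷ xs) ys with p x
... | true  = cong suc (countᵇ-++ p xs ys)
... | false = countᵇ-++ p xs ys

countᵇ-map : (p : B → Bool) (f : A → B) (xs : List A) → countᵇ p (map f xs) ≡ countᵇ (p ∘ f) xs
countᵇ-map p f [] = refl
countᵇ-map p f (x ∷ xs) with p (f x)
... | true  = cong suc (countᵇ-map p f xs)
... | false = countᵇ-map p f xs

countᵇ-filterᵇ : (p q : A → Bool) (xs : List A) → countᵇ p (filterᵇ q xs) ≡ countᵇ (λ x → q x ∧ p x) xs
countᵇ-filterᵇ p q [] = refl
countᵇ-filterᵇ p q (x ∷ xs) with q x
... | false = countᵇ-filterᵇ p q xs
... | true with p x
...   | true  = cong suc (countᵇ-filterᵇ p q xs)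
...   | false = countᵇ-filterᵇ p q xs

filterᵇ-cong : {p q : A → Bool} (xs : List A) → (∀ {x} → x ∈ xs → p x ≡ q x) →
  filterᵇ p xs ≡ filterᵇ q xs
filterᵇ-cong [] _ = refl
filterᵇ-cong {p = p} {q} (x ∷ xs) p≗q with p x | q x | p≗q (here refl)
... | true  | true  | refl = cong (x ∷_) (filterᵇ-cong xs (p≗q ∘ there))
... | false | false | refl = filterᵇ-cong xs (p≗q ∘ there)

∈-filterᵇ⁺ : (p : A → Bool) {xs : List A} {x : A} → x ∈ xs → p x ≡ true → x ∈ filterᵇ p xs
∈-filterᵇ⁺ p x∈xs px = ∈-filter⁺ (T? ∘ p) x∈xs (Equivalence.from T-≡ px)

∈-filterᵇ⁻ : (p : A → Bool) (xs : List A) {x : A} → x ∈ filterᵇ p xs → x ∈ xs × p x ≡ true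
∈-filterᵇ⁻ p xs x∈ with ∈-filter⁻ (T? ∘ p) {xs = xs} x∈
... | x∈xs , px = x∈xs , Equivalence.to T-≡ px

unique-map⁺ : {f : A → B} {xs : List A} → (∀ {x y} → x ∈ xs → y ∈ xs → f x ≡ f y → x ≡ y) →
  Unique xs → Unique (map f xs)
unique-map⁺ {xs = []} _ [] = []
unique-map⁺ {f = f} {x ∷ xs} inj (x∉xs ∷ xs!) =
  fresh (λ y∈xs → inj (here refl) (there y∈xs)) x∉xs ∷ unique-map⁺ (λ u v → inj (there u) (there v)) xs!
  where
  fresh : ∀ {ys} → (∀ {y} → y ∈ ys → f x ≡ f y → x ≡ y) →
    All (λ z → ¬ x ≡ z) ys → All (λ z → ¬ f x ≡ z) (map f ys)
  fresh _ [] = []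
  fresh inj′ (x≢y ∷ x∉ys) = (x≢y ∘ inj′ (here refl)) ∷ fresh (inj′ ∘ there) x∉ys

countᵇ-bijection : (xs : List A) (ys : List B) → Unique xs → Unique ys →
  (p : A → Bool) (q : B → Bool) (f : A → B) (g : B → A) →
  (∀ {x} → x ∈ xs → p x ≡ true → f x ∈ ys × q (f x) ≡ true × g (f x) ≡ x) →
  (∀ {y} → y ∈ ys → q y ≡ true → g y ∈ xs × p (g y) ≡ true × f (g y) ≡ y) →
  countᵇ p xs ≡ countᵇ q ys
countᵇ-bijection xs ys xs! ys! p q f g forth back =
  trans (sym (length-map f (filterᵇ p xs)))
        (↭-length (∼bag⇒↭ (unique∧set⇒bag image! (Unique.filter⁺ (T? ∘ q) ys!) (mk⇔ to from))))
  where
  injective : ∀ {x x′} → x ∈ filterᵇ p xs → x′ ∈ filterᵇ p xs → f x ≡ f x′ → x ≡ x′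
  injective x∈ x′∈ fx≡fx′ with ∈-filterᵇ⁻ p xs x∈ | ∈-filterᵇ⁻ p xs x′∈
  ... | x∈xs , px | x′∈xs , px′ =
    trans (sym (proj₂ (proj₂ (forth x∈xs px)))) (trans (cong g fx≡fx′) (proj₂ (proj₂ (forth x′∈xs px′))))
  image! : Unique (map f (filterᵇ p xs))
  image! = unique-map⁺ injective (Unique.filter⁺ (T? ∘ p) xs!)
  to : ∀ {y} → y ∈ map f (filterᵇ p xs) → y ∈ filterᵇ q ys
  to y∈ with ∈-map⁻ f y∈
  ... | x , x∈ , refl with ∈-filterᵇ⁻ p xs x∈
  ... | x∈xs , px = ∈-filterᵇ⁺ q (proj₁ (forth x∈xs px)) (proj₁ (proj₂ (forth x∈xs px)))
  from : ∀ {y} → y ∈ filterᵇ q ys → y ∈ map f (filterᵇ p xs)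
  from y∈ with ∈-filterᵇ⁻ q ys y∈
  ... | y∈ys , qy with back y∈ys qy
  ... | gy∈xs , pgy , fgy≡y = subst (_∈ map f (filterᵇ p xs)) fgy≡y (∈-map⁺ f (∈-filterᵇ⁺ p gy∈xs pgy))

eqᵇ⇒≡ : {S T : Subset n} → eqᵇ S T ≡ true → S ≡ T
eqᵇ⇒≡ {S = []}      {[]}      _ = refl
eqᵇ⇒≡ {S = true ∷ S}  {true ∷ T}  e = cong (true ∷_) (eqᵇ⇒≡ e)
eqᵇ⇒≡ {S = false ∷ S} {false ∷ T} e = cong (false ∷_) (eqᵇ⇒≡ e)

eqᵇ-refl : (S : Subset n) → eqᵇ S S ≡ true
eqᵇ-refl [] = refl
eqᵇ-refl (true ∷ S) = eqᵇ-refl S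
eqᵇ-refl (false ∷ S) = eqᵇ-refl S

≢⇒eqᵇ≡false : {S T : Subset n} → ¬ S ≡ T → eqᵇ S T ≡ false
≢⇒eqᵇ≡false {S = S} {T} S≢T with eqᵇ S T in e
... | true  = ⊥-elim (S≢T (eqᵇ⇒≡ e))
... | false = refl

memᵇ⇒∈ : {S : Subset n} (F : List (Subset n)) → memᵇ S F ≡ true → S ∈ F
memᵇ⇒∈ {S = S} (T ∷ F) e with ∨≡true⁻ (eqᵇ S T) e
... | inj₁ S≡T = here (eqᵇ⇒≡ S≡T)
... | inj₂ S∈F = there (memᵇ⇒∈ F S∈F)

∈⇒memᵇ : {S : Subset n} {F : List (Subset n)} → S ∈ F → memᵇ S F ≡ true
∈⇒memᵇ {S = S} {_ ∷ F} (here refl) = cong (_∨ memᵇ S F) (eqᵇ-refl S)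
∈⇒memᵇ {S = S} {T ∷ _} (there S∈F) = trans (cong (eqᵇ S T ∨_) (∈⇒memᵇ S∈F)) (∨-zeroʳ (eqᵇ S T))

memᵇ-filterᵇ : (p : Subset n → Bool) (U : List (Subset n)) {S : Subset n} → S ∈ U →
  memᵇ S (filterᵇ p U) ≡ p S
memᵇ-filterᵇ p U S∈U =
  ≡true-ext (λ e → proj₂ (∈-filterᵇ⁻ p U (memᵇ⇒∈ _ e))) (∈⇒memᵇ ∘ ∈-filterᵇ⁺ p S∈U)

∈-allSubsets : (S : Subset n) → S ∈ allSubsets n
∈-allSubsets [] = here refl
∈-allSubsets (true ∷ S) = ∈-++⁺ˡ (∈-map⁺ (true ∷_) (∈-allSubsets S))
∈-allSubsets {suc n} (false ∷ S) = ∈-++⁺ʳ (map (true ∷_) (allSubsets n)) (∈-map⁺ (false ∷_) (∈-allSubsets S))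

allSubsets-unique : (n : ℕ) → Unique (allSubsets n)
allSubsets-unique zero = [] ∷ []
allSubsets-unique (suc n) =
  Unique.++⁺ (tagged true) (tagged false) disjoint
  where
  tagged : (b : Bool) → Unique (map (b ∷_) (allSubsets n))
  tagged b = Unique.map⁺ Vec.∷-injectiveʳ (allSubsets-unique n)
  disjoint : ∀ {S} → ¬ (S ∈ map (true ∷_) (allSubsets n) × S ∈ map (false ∷_) (allSubsets n))
  disjoint (S∈₁ , S∈₂) with ∈-map⁻ (true ∷_) S∈₁ | ∈-map⁻ (false ∷_) S∈₂
  ... | _ , _ , refl | _ , _ , ()

∈-allFins : (i : Fin n) → i ∈ allFins n
∈-allFins zero = here refl
∈-allFins (suc i) = there (∈-map⁺ suc (∈-allFins i))

filterᵇ∈sublists : (p : A → Bool) (xs : List A) → filterᵇ p xs ∈ sublists xs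
filterᵇ∈sublists p [] = here refl
filterᵇ∈sublists p (x ∷ xs) with p x
... | true  = ∈-++⁺ˡ (∈-map⁺ (x ∷_) (filterᵇ∈sublists p xs))
... | false = ∈-++⁺ʳ (map (x ∷_) (sublists xs)) (filterᵇ∈sublists p xs)

∈-sublists⇒⊆ : {xs ys : List A} {x : A} → ys ∈ sublists xs → x ∈ ys → x ∈ xs
∈-sublists⇒⊆ {xs = []} (here refl) ()
∈-sublists⇒⊆ {xs = y ∷ xs} ys∈ x∈ys with ∈-++⁻ (map (y ∷_) (sublists xs)) ys∈
... | inj₂ ys∈′ = there (∈-sublists⇒⊆ ys∈′ x∈ys)
... | inj₁ ys∈′ with ∈-map⁻ (y ∷_) ys∈′
...   | _ , ys′∈ , refl with x∈ys
...     | here refl = here refl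
...     | there x∈ys′ = there (∈-sublists⇒⊆ ys′∈ x∈ys′)

sublists-unique : (xs : List A) → Unique xs → Unique (sublists xs)
sublists-unique [] _ = [] ∷ []
sublists-unique (x ∷ xs) (x∉xs ∷ xs!) =
  Unique.++⁺ (Unique.map⁺ ∷-injectiveʳ (sublists-unique xs xs!)) (sublists-unique xs xs!) disjoint
  where
  disjoint : ∀ {ys} → ¬ (ys ∈ map (x ∷_) (sublists xs) × ys ∈ sublists xs)
  disjoint (ys∈₁ , ys∈₂) with ∈-map⁻ (x ∷_) ys∈₁
  ... | _ , _ , refl = All-lookup x∉xs (∈-sublists⇒⊆ ys∈₂ (here refl)) refl

filterᵇ-memᵇ-sublist : (U : List (Subset n)) → Unique U → {F : List (Subset n)} → F ∈ sublists U →
  filterᵇ (λ S → memᵇ S F) U ≡ F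
filterᵇ-memᵇ-sublist [] _ (here refl) = refl
filterᵇ-memᵇ-sublist (S ∷ U) (S∉U ∷ U!) {F} F∈ with ∈-++⁻ (map (S ∷_) (sublists U)) F∈
... | inj₁ F∈₁ with ∈-map⁻ (S ∷_) F∈₁
...   | F′ , F′∈ , refl rewrite eqᵇ-refl S =
  cong (S ∷_) (trans (filterᵇ-cong U (λ T∈U → cong (_∨ _) (≢⇒eqᵇ≡false (All-lookup S∉U T∈U ∘ sym))))
                     (filterᵇ-memᵇ-sublist U U! F′∈))
filterᵇ-memᵇ-sublist (S ∷ U) (S∉U ∷ U!) {F} F∈ | inj₂ F∈₂ with memᵇ S F in e
... | true  = ⊥-elim (All-lookup S∉U (∈-sublists⇒⊆ F∈₂ (memᵇ⇒∈ F e)) refl)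
... | false = filterᵇ-memᵇ-sublist U U! F∈₂

∁-involutive : (S : Subset n) → ∁ (∁ S) ≡ S
∁-involutive = SubsetAlgebra.¬-involutive

∁⊥≡⊤ : ∁ (⊥ {n}) ≡ ⊤
∁⊥≡⊤ = SubsetAlgebra.¬⊥≈⊤

eqᵇ-∁-⊤ : (S : Subset n) → eqᵇ (∁ S) ⊤ ≡ isEmptyᵇ S
eqᵇ-∁-⊤ [] = refl
eqᵇ-∁-⊤ (true ∷ S) = refl
eqᵇ-∁-⊤ (false ∷ S) = eqᵇ-∁-⊤ S

subᵇ≡isEmptyᵇ-∩∁ : (S T : Subset n) → subᵇ S T ≡ isEmptyᵇ (S ∩ ∁ T)
subᵇ≡isEmptyᵇ-∩∁ [] [] = refl
subᵇ≡isEmptyᵇ-∩∁ (true ∷ S)  (true ∷ T)  = subᵇ≡isEmptyᵇ-∩∁ S T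
subᵇ≡isEmptyᵇ-∩∁ (true ∷ S)  (false ∷ T) = refl
subᵇ≡isEmptyᵇ-∩∁ (false ∷ S) (true ∷ T)  = subᵇ≡isEmptyᵇ-∩∁ S T
subᵇ≡isEmptyᵇ-∩∁ (false ∷ S) (false ∷ T) = subᵇ≡isEmptyᵇ-∩∁ S T

eqᵇ-∪-⊤≡isEmptyᵇ-∁∩∁ : (S T : Subset n) → eqᵇ (S ∪ T) ⊤ ≡ isEmptyᵇ (∁ S ∩ ∁ T)
eqᵇ-∪-⊤≡isEmptyᵇ-∁∩∁ [] [] = refl
eqᵇ-∪-⊤≡isEmptyᵇ-∁∩∁ (true ∷ S)  (true ∷ T)  = eqᵇ-∪-⊤≡isEmptyᵇ-∁∩∁ S T
eqᵇ-∪-⊤≡isEmptyᵇ-∁∩∁ (true ∷ S)  (false ∷ T) = eqᵇ-∪-⊤≡isEmptyᵇ-∁∩∁ S T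
eqᵇ-∪-⊤≡isEmptyᵇ-∁∩∁ (false ∷ S) (true ∷ T)  = eqᵇ-∪-⊤≡isEmptyᵇ-∁∩∁ S T
eqᵇ-∪-⊤≡isEmptyᵇ-∁∩∁ (false ∷ S) (false ∷ T) = refl

clusterCompatibleᵇ : Subset n → Subset n → Bool
clusterCompatibleᵇ A B = isEmptyᵇ (A ∩ B) ∨ subᵇ A B ∨ subᵇ B A

splitCompatibleᵇ : Subset n → Subset n → Bool
splitCompatibleᵇ A B = isEmptyᵇ (A ∩ B) ∨ subᵇ A B ∨ subᵇ B A ∨ eqᵇ (A ∪ B) ⊤

someQuadrantEmptyᵇ : Subset n → Subset n → Bool
someQuadrantEmptyᵇ A B =
  isEmptyᵇ (A ∩ B) ∨ isEmptyᵇ (A ∩ ∁ B) ∨ isEmptyᵇ (∁ A ∩ B) ∨ isEmptyᵇ (∁ A ∩ ∁ B)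

splitCompatibleᵇ≡someQuadrantEmptyᵇ : (A B : Subset n) → splitCompatibleᵇ A B ≡ someQuadrantEmptyᵇ A B
splitCompatibleᵇ≡someQuadrantEmptyᵇ A B
  rewrite subᵇ≡isEmptyᵇ-∩∁ A B | subᵇ≡isEmptyᵇ-∩∁ B A | eqᵇ-∪-⊤≡isEmptyᵇ-∁∩∁ A B | ∩-comm B (∁ A)
  = refl

splitCompatibleᵇ-∁ˡ : (A B : Subset n) → splitCompatibleᵇ (∁ A) B ≡ splitCompatibleᵇ A B
splitCompatibleᵇ-∁ˡ A B
  rewrite splitCompatibleᵇ≡someQuadrantEmptyᵇ (∁ A) B | splitCompatibleᵇ≡someQuadrantEmptyᵇ A B
        | ∁-involutive A =
  swap-halves (isEmptyᵇ (A ∩ B)) (isEmptyᵇ (A ∩ ∁ B)) (isEmptyᵇ (∁ A ∩ B)) (isEmptyᵇ (∁ A ∩ ∁ B))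
  where
  swap-halves : (a b c d : Bool) → c ∨ d ∨ a ∨ b ≡ a ∨ b ∨ c ∨ d
  swap-halves a b c d = trans (sym (∨-assoc c d (a ∨ b))) (trans (∨-comm (c ∨ d) (a ∨ b)) (∨-assoc a b (c ∨ d)))

splitCompatibleᵇ-∁ʳ : (A B : Subset n) → splitCompatibleᵇ A (∁ B) ≡ splitCompatibleᵇ A B
splitCompatibleᵇ-∁ʳ A B
  rewrite splitCompatibleᵇ≡someQuadrantEmptyᵇ A (∁ B) | splitCompatibleᵇ≡someQuadrantEmptyᵇ A B
        | ∁-involutive B =
  swap-within-halves (isEmptyᵇ (A ∩ B)) (isEmptyᵇ (A ∩ ∁ B)) (isEmptyᵇ (∁ A ∩ B)) (isEmptyᵇ (∁ A ∩ ∁ B))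
  where
  swap-within-halves : (a b c d : Bool) → b ∨ a ∨ d ∨ c ≡ a ∨ b ∨ c ∨ d
  swap-within-halves a b c d =
    trans (sym (∨-assoc b a (d ∨ c))) (trans (cong₂ _∨_ (∨-comm b a) (∨-comm d c)) (∨-assoc a b (c ∨ d)))

-- The new leaf 0 is the head of the vector: a cluster A becomes the split with sides false ∷ A and true ∷ ∁ A.
isSplitSideOf : List (Subset n) → Subset (suc n) → Bool
isSplitSideOf H (true ∷ A)  = memᵇ (∁ A) H
isSplitSideOf H (false ∷ A) = memᵇ A H

toSplits : List (Subset n) → List (Subset (suc n))
toSplits {n} H = filterᵇ (isSplitSideOf H) (allSubsets (suc n))

toClusters : List (Subset (suc n)) → List (Subset n)
toClusters {n} F = filterᵇ (λ A → memᵇ (false ∷ A) F) (allSubsets n)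

memᵇ-toSplits : (H : List (Subset n)) (S : Subset (suc n)) → memᵇ S (toSplits H) ≡ isSplitSideOf H S
memᵇ-toSplits H S = memᵇ-filterᵇ (isSplitSideOf H) _ (∈-allSubsets S)

all-toSplits : (p : Subset (suc n) → Bool) (H : List (Subset n)) →
  all p (toSplits H) ≡ all (λ A → p (false ∷ A) ∧ p (true ∷ ∁ A)) H
all-toSplits {n} p H = all-image₂ p (false ∷_) (λ A → true ∷ ∁ A) H (toSplits H) onto into
  where
  onto : ∀ {S} → S ∈ toSplits H → ∃ λ A → A ∈ H × (S ≡ false ∷ A ⊎ S ≡ true ∷ ∁ A)
  onto {S} S∈ with ∈-filterᵇ⁻ (isSplitSideOf H) (allSubsets (suc n)) S∈
  onto {true ∷ A}  _ | _ , ∁A∈H = ∁ A , memᵇ⇒∈ H ∁A∈H , inj₂ (cong (true ∷_) (sym (∁-involutive A)))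
  onto {false ∷ A} _ | _ , A∈H  = A , memᵇ⇒∈ H A∈H , inj₁ refl
  into : ∀ {A} → A ∈ H → (false ∷ A) ∈ toSplits H × (true ∷ ∁ A) ∈ toSplits H
  into {A} A∈H =
    ∈-filterᵇ⁺ (isSplitSideOf H) (∈-allSubsets _) (∈⇒memᵇ A∈H) ,
    ∈-filterᵇ⁺ (isSplitSideOf H) (∈-allSubsets _)
               (subst (λ S → memᵇ S H ≡ true) (sym (∁-involutive A)) (∈⇒memᵇ A∈H))

any-toSplits : (p : Subset (suc n) → Bool) (H : List (Subset n)) →
  any p (toSplits H) ≡ any (λ A → p (false ∷ A) ∨ p (true ∷ ∁ A)) H
any-toSplits p H = begin
  any p (toSplits H)                                          ≡⟨ any≡not-all-not p (toSplits H) ⟩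
  not (all (not ∘ p) (toSplits H))                            ≡⟨ cong not (all-toSplits (not ∘ p) H) ⟩
  not (all (λ A → not (p (false ∷ A)) ∧ not (p (true ∷ ∁ A))) H)
    ≡⟨ cong not (all-cong H (λ A → sym (BoolAlgebra.deMorgan₂ (p (false ∷ A)) (p (true ∷ ∁ A))))) ⟩
  not (all (λ A → not (p (false ∷ A) ∨ p (true ∷ ∁ A))) H)  ≡⟨ sym (any≡not-all-not _ H) ⟩
  any (λ A → p (false ∷ A) ∨ p (true ∷ ∁ A)) H                ∎
  where open ≡-Reasoning

isSplitSystem-toSplits : (H : List (Subset n)) → isSplitSystem (toSplits H) ≡ isHierarchy H
isSplitSystem-toSplits {n} H =
  trans (cong₂ _∧_ complement-closed (cong₂ _∧_ proper (cong₂ _∧_ pendant compatible))) (reorder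
    (memᵇ ⊤ H) (all (λ i → memᵇ ⁅ i ⁆ H) (allFins n)) (all (λ A → not (isEmptyᵇ A)) H)
    (all (λ A → all (clusterCompatibleᵇ A) H) H))
  where
  complement-closed : all (λ A → memᵇ (∁ A) (toSplits H)) (toSplits H) ≡ true
  complement-closed = trans (all-toSplits _ H) (all⁺ _ {H} λ {A} A∈H → begin
    memᵇ (∁ (false ∷ A)) (toSplits H) ∧ memᵇ (∁ (true ∷ ∁ A)) (toSplits H)
      ≡⟨ cong₂ _∧_ (memᵇ-toSplits H (∁ (false ∷ A))) (memᵇ-toSplits H (∁ (true ∷ ∁ A))) ⟩
    memᵇ (∁ (∁ A)) H ∧ memᵇ (∁ (∁ A)) H  ≡⟨ ∧-idem _ ⟩
    memᵇ (∁ (∁ A)) H                      ≡⟨ cong (λ B → memᵇ B H) (∁-involutive A) ⟩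
    memᵇ A H                              ≡⟨ ∈⇒memᵇ {F = H} A∈H ⟩
    true                                  ∎)
    where open ≡-Reasoning

  proper : all (λ A → not (isEmptyᵇ A) ∧ not (eqᵇ A ⊤)) (toSplits H) ≡ all (λ A → not (isEmptyᵇ A)) H
  proper = trans (all-toSplits _ H) (all-cong H λ A →
    trans (cong (λ e → (not (isEmptyᵇ A) ∧ true) ∧ not e) (eqᵇ-∁-⊤ A))
          (trans (cong (_∧ not (isEmptyᵇ A)) (∧-identityʳ _)) (∧-idem _)))

  pendant : all (λ i → memᵇ ⁅ i ⁆ (toSplits H)) (allFins (suc n)) ≡
            memᵇ ⊤ H ∧ all (λ i → memᵇ ⁅ i ⁆ H) (allFins n)
  pendant = cong₂ _∧_ (trans (memᵇ-toSplits H (true ∷ ⊥)) (cong (λ B → memᵇ B H) ∁⊥≡⊤))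
    (trans (all-map _ suc (allFins n)) (all-cong (allFins n) (λ i → memᵇ-toSplits H (false ∷ ⁅ i ⁆))))

  compatible : all (λ A → all (splitCompatibleᵇ A) (toSplits H)) (toSplits H) ≡
               all (λ A → all (clusterCompatibleᵇ A) H) H
  compatible = trans (all-cong (toSplits H) inner) (trans (all-toSplits _ H) (all-cong H outer))
    where
    withCluster : Subset (suc n) → Bool
    withCluster S = all (λ B → splitCompatibleᵇ S (false ∷ B)) H
    inner : ∀ S → all (splitCompatibleᵇ S) (toSplits H) ≡ withCluster S
    inner S = trans (all-toSplits _ H) (all-cong H λ B →
      trans (cong (splitCompatibleᵇ S (false ∷ B) ∧_) (splitCompatibleᵇ-∁ʳ S (false ∷ B))) (∧-idem _))
    outer : ∀ A → withCluster (false ∷ A) ∧ withCluster (true ∷ ∁ A) ≡ all (clusterCompatibleᵇ A) H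
    outer A =
      trans (cong (withCluster (false ∷ A) ∧_) (all-cong H λ B → splitCompatibleᵇ-∁ˡ (false ∷ A) (false ∷ B)))
            (trans (∧-idem _) (all-cong H λ B →
              cong (λ b → isEmptyᵇ (A ∩ B) ∨ subᵇ A B ∨ b) (∨-identityʳ (subᵇ B A))))

  reorder : (m s e c : Bool) → e ∧ (m ∧ s) ∧ c ≡ m ∧ s ∧ e ∧ c
  reorder m s e c = trans (sym (∧-assoc e (m ∧ s) c))
    (trans (cong (_∧ c) (∧-comm e (m ∧ s))) (trans (∧-assoc (m ∧ s) e c) (∧-assoc m s (e ∧ c))))

_△_ : Subset n → Subset n → Subset n
C △ X = zipWith _xor_ C X

△-cancelʳ : (C X : Subset n) → (C △ X) △ X ≡ C
△-cancelʳ [] [] = refl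
△-cancelʳ (c ∷ C) (x ∷ X) =
  cong₂ _∷_ (trans (xor-assoc c x x) (trans (cong (c xor_) (xor-same x)) (xor-identityʳ c))) (△-cancelʳ C X)

eqᵇ-△-self : (C X : Subset n) → eqᵇ (C △ X) X ≡ isEmptyᵇ C
eqᵇ-△-self [] [] = refl
eqᵇ-△-self (true ∷ C)  (true ∷ X)  = refl
eqᵇ-△-self (true ∷ C)  (false ∷ X) = refl
eqᵇ-△-self (false ∷ C) (true ∷ X)  = eqᵇ-△-self C X
eqᵇ-△-self (false ∷ C) (false ∷ X) = eqᵇ-△-self C X

eqᵇ-∁∩-△ : (A C X : Subset n) → eqᵇ (∁ A ∩ X) (C △ X) ≡ eqᵇ (A ∩ X) C
eqᵇ-∁∩-△ [] [] [] = refl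
eqᵇ-∁∩-△ (true ∷ A)  (true ∷ C)  (true ∷ X)  = eqᵇ-∁∩-△ A C X
eqᵇ-∁∩-△ (true ∷ A)  (false ∷ C) (true ∷ X)  = refl
eqᵇ-∁∩-△ (false ∷ A) (true ∷ C)  (true ∷ X)  = refl
eqᵇ-∁∩-△ (false ∷ A) (false ∷ C) (true ∷ X)  = eqᵇ-∁∩-△ A C X
eqᵇ-∁∩-△ (true ∷ A)  (true ∷ C)  (false ∷ X) = refl
eqᵇ-∁∩-△ (true ∷ A)  (false ∷ C) (false ∷ X) = eqᵇ-∁∩-△ A C X
eqᵇ-∁∩-△ (false ∷ A) (true ∷ C)  (false ∷ X) = refl
eqᵇ-∁∩-△ (false ∷ A) (false ∷ C) (false ∷ X) = eqᵇ-∁∩-△ A C X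

countᵇ-allSubsets-involution : (p : Subset n → Bool) (h : Subset n → Subset n) → (∀ S → h (h S) ≡ S) →
  countᵇ p (allSubsets n) ≡ countᵇ (p ∘ h) (allSubsets n)
countᵇ-allSubsets-involution {n} p h h∘h≡id =
  sym (countᵇ-bijection (allSubsets n) (allSubsets n) (allSubsets-unique n) (allSubsets-unique n) (p ∘ h) p h h
    (λ {S} _ phS → ∈-allSubsets _ , phS , h∘h≡id S)
    (λ {S} _ pS → ∈-allSubsets _ , subst (λ T → p T ≡ true) (sym (h∘h≡id S)) pS , h∘h≡id S))

-- A restricted side true ∷ C containing the new leaf comes from a side true ∷ ∁ A, so C = ∁ A ∩ X;
-- the involution C ↦ C △ X of Subset n turns it into the restricted cluster A ∩ X.
restrictedSides-toSplits : (H : List (Subset n)) (X : Subset n) →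
  restrictedSides (toSplits H) (true ∷ X) ≡ restrictedClusters H X + restrictedClusters H X
restrictedSides-toSplits {n} H X = begin
  countᵇ side (map (true ∷_) (allSubsets n) ++ map (false ∷_) (allSubsets n))
    ≡⟨ countᵇ-++ side (map (true ∷_) (allSubsets n)) (map (false ∷_) (allSubsets n)) ⟩
  countᵇ side (map (true ∷_) (allSubsets n)) + countᵇ side (map (false ∷_) (allSubsets n))
    ≡⟨ cong₂ _+_ (countᵇ-map side (true ∷_) (allSubsets n)) (countᵇ-map side (false ∷_) (allSubsets n)) ⟩
  countᵇ (side ∘ (true ∷_)) (allSubsets n) + countᵇ (side ∘ (false ∷_)) (allSubsets n)
    ≡⟨ cong (_+ countᵇ (side ∘ (false ∷_)) (allSubsets n))
            (countᵇ-allSubsets-involution (side ∘ (true ∷_)) (_△ X) (λ C → △-cancelʳ C X)) ⟩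
  countᵇ (λ C → side (true ∷ C △ X)) (allSubsets n) + countᵇ (side ∘ (false ∷_)) (allSubsets n)
    ≡⟨ cong₂ _+_ (countᵇ-cong (allSubsets n) withLeaf) (countᵇ-cong (allSubsets n) withoutLeaf) ⟩
  restrictedClusters H X + restrictedClusters H X ∎
  where
  open ≡-Reasoning
  side : Subset (suc n) → Bool
  side S = not (isEmptyᵇ S) ∧ not (eqᵇ S (true ∷ X)) ∧ any (λ A → eqᵇ (A ∩ (true ∷ X)) S) (toSplits H)
  cluster : Subset n → Bool
  cluster C = not (isEmptyᵇ C) ∧ any (λ A → eqᵇ (A ∩ X) C) H
  withLeaf : ∀ C → side (true ∷ C △ X) ≡ cluster C
  withLeaf C = cong₂ (λ a b → not a ∧ b) (eqᵇ-△-self C X)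
    (trans (any-toSplits _ H) (any-cong H (λ A → eqᵇ-∁∩-△ A C X)))
  withoutLeaf : ∀ C → side (false ∷ C) ≡ cluster C
  withoutLeaf C = cong (not (isEmptyᵇ C) ∧_) (trans (any-toSplits _ H) (any-cong H (λ A → ∨-identityʳ _)))

memᵇ-∁ : (F : List (Subset n)) → all (λ A → memᵇ (∁ A) F) F ≡ true →
  (S : Subset n) → memᵇ (∁ S) F ≡ memᵇ S F
memᵇ-∁ F closed S = ≡true-ext
  (λ ∁S∈F → subst (λ T → memᵇ T F ≡ true) (∁-involutive S) (∁-mem (memᵇ⇒∈ {S = ∁ S} F ∁S∈F)))
  (λ S∈F → ∁-mem (memᵇ⇒∈ {S = S} F S∈F))
  where
  ∁-mem : ∀ {T} → T ∈ F → memᵇ (∁ T) F ≡ true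
  ∁-mem = all⁻ (λ A → memᵇ (∁ A) F) closed

toClusters-toSplits : (H : List (Subset n)) → H ∈ sublists (allSubsets n) → toClusters (toSplits H) ≡ H
toClusters-toSplits {n} H H∈ =
  trans (filterᵇ-cong (allSubsets n) (λ {A} _ → memᵇ-toSplits H (false ∷ A)))
        (filterᵇ-memᵇ-sublist (allSubsets n) (allSubsets-unique n) H∈)

toSplits-toClusters : (F : List (Subset (suc n))) → F ∈ sublists (allSubsets (suc n)) → isSplitSystem F ≡ true →
  toSplits (toClusters F) ≡ F
toSplits-toClusters {n} F F∈ splitSystem =
  trans (filterᵇ-cong (allSubsets (suc n)) sameSides)
        (filterᵇ-memᵇ-sublist (allSubsets (suc n)) (allSubsets-unique (suc n)) F∈)
  where
  sameSides : ∀ {S} → S ∈ allSubsets (suc n) → isSplitSideOf (toClusters F) S ≡ memᵇ S F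
  sameSides {true ∷ A} _ =
    trans (memᵇ-filterᵇ _ (allSubsets n) (∈-allSubsets (∁ A)))
          (memᵇ-∁ F (∧-conicalˡ _ _ splitSystem) (true ∷ A))
  sameSides {false ∷ A} _ = memᵇ-filterᵇ _ (allSubsets n) (∈-allSubsets A)

countᵇ-rooted≡countᵇ-unrooted : (pr : List (Subset n) → Bool) (pu : List (Subset (suc n)) → Bool) →
  (∀ H → pu (toSplits H) ≡ pr H) →
  countᵇ (λ H → isHierarchy H ∧ pr H) (sublists (allSubsets n)) ≡
  countᵇ (λ F → isSplitSystem F ∧ pu F) (sublists (allSubsets (suc n)))
countᵇ-rooted≡countᵇ-unrooted {n} pr pu pu≗pr =
  countᵇ-bijection _ _ (sublists-unique _ (allSubsets-unique n)) (sublists-unique _ (allSubsets-unique (suc n)))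
    rooted unrooted toSplits toClusters forth back
  where
  rooted : List (Subset n) → Bool
  rooted H = isHierarchy H ∧ pr H
  unrooted : List (Subset (suc n)) → Bool
  unrooted F = isSplitSystem F ∧ pu F
  unrooted-toSplits : ∀ H → unrooted (toSplits H) ≡ rooted H
  unrooted-toSplits H = cong₂ _∧_ (isSplitSystem-toSplits H) (pu≗pr H)
  forth : ∀ {H} → H ∈ sublists (allSubsets n) → rooted H ≡ true →
    toSplits H ∈ sublists (allSubsets (suc n)) × unrooted (toSplits H) ≡ true × toClusters (toSplits H) ≡ H
  forth {H} H∈ rootedH =
    filterᵇ∈sublists (isSplitSideOf H) (allSubsets (suc n)) ,
    trans (unrooted-toSplits H) rootedH ,
    toClusters-toSplits H H∈
  back : ∀ {F} → F ∈ sublists (allSubsets (suc n)) → unrooted F ≡ true →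
    toClusters F ∈ sublists (allSubsets n) × rooted (toClusters F) ≡ true × toSplits (toClusters F) ≡ F
  back {F} F∈ unrootedF =
    filterᵇ∈sublists (λ A → memᵇ (false ∷ A) F) (allSubsets n) ,
    trans (sym (unrooted-toSplits (toClusters F))) (subst (λ G → unrooted G ≡ true) (sym F≡) unrootedF) ,
    F≡
    where
    F≡ : toSplits (toClusters F) ≡ F
    F≡ = toSplits-toClusters F F∈ (∧-conicalˡ _ _ unrootedF)

lookup-ext : {S T : Subset n} → (∀ i → lookup S i ≡ lookup T i) → S ≡ T
lookup-ext {S = S} {T} S≗T = trans (sym (tabulate∘lookup S)) (trans (tabulate-cong S≗T) (tabulate∘lookup T))

relabel : (Fin n → Fin n) → Subset n → Subset n
relabel σ S = tabulate (lookup S ∘ σ)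

lookup-relabel : (σ : Fin n → Fin n) (S : Subset n) (i : Fin n) → lookup (relabel σ S) i ≡ lookup S (σ i)
lookup-relabel σ S = lookup∘tabulate (lookup S ∘ σ)

module _ (σ : Fin n → Fin n) where

  relabel-zipWith : (f : Bool → Bool → Bool) (S T : Subset n) →
    relabel σ (zipWith f S T) ≡ zipWith f (relabel σ S) (relabel σ T)
  relabel-zipWith f S T = lookup-ext λ i → begin
    lookup (relabel σ (zipWith f S T)) i                ≡⟨ lookup-relabel σ (zipWith f S T) i ⟩
    lookup (zipWith f S T) (σ i)                        ≡⟨ lookup-zipWith f (σ i) S T ⟩
    f (lookup S (σ i)) (lookup T (σ i))                 ≡⟨ cong₂ f (lookup-relabel σ S i) (lookup-relabel σ T i) ⟨
    f (lookup (relabel σ S) i) (lookup (relabel σ T) i) ≡⟨ lookup-zipWith f i (relabel σ S) (relabel σ T) ⟨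
    lookup (zipWith f (relabel σ S) (relabel σ T)) i    ∎
    where open ≡-Reasoning

  relabel-∁ : (S : Subset n) → relabel σ (∁ S) ≡ ∁ (relabel σ S)
  relabel-∁ S = lookup-ext λ i → begin
    lookup (relabel σ (∁ S)) i    ≡⟨ lookup-relabel σ (∁ S) i ⟩
    lookup (∁ S) (σ i)            ≡⟨ lookup-map (σ i) not S ⟩
    not (lookup S (σ i))          ≡⟨ cong not (lookup-relabel σ S i) ⟨
    not (lookup (relabel σ S) i)  ≡⟨ lookup-map i not (relabel σ S) ⟨
    lookup (∁ (relabel σ S)) i    ∎
    where open ≡-Reasoning

  relabel-replicate : (b : Bool) → relabel σ (replicate n b) ≡ replicate n b
  relabel-replicate b = lookup-ext λ i →
    trans (lookup-relabel σ (replicate n b) i) (trans (lookup-replicate (σ i) b) (sym (lookup-replicate i b)))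

isEmptyᵇ≡eqᵇ-⊥ : (S : Subset n) → isEmptyᵇ S ≡ eqᵇ S ⊥
isEmptyᵇ≡eqᵇ-⊥ [] = refl
isEmptyᵇ≡eqᵇ-⊥ (true ∷ S) = refl
isEmptyᵇ≡eqᵇ-⊥ (false ∷ S) = isEmptyᵇ≡eqᵇ-⊥ S

lookup-⁅⁆-self : (i : Fin n) → lookup ⁅ i ⁆ i ≡ true
lookup-⁅⁆-self zero = refl
lookup-⁅⁆-self (suc i) = lookup-⁅⁆-self i

lookup-⁅⁆⇒≡ : (i j : Fin n) → lookup ⁅ i ⁆ j ≡ true → i ≡ j
lookup-⁅⁆⇒≡ zero zero _ = refl
lookup-⁅⁆⇒≡ {suc n} zero (suc j) e with () ← trans (sym (lookup-replicate j false)) e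
lookup-⁅⁆⇒≡ (suc i) (suc j) e = cong suc (lookup-⁅⁆⇒≡ i j e)

relabelSplits : (Fin n → Fin n) → List (Subset n) → List (Subset n)
relabelSplits {n} σ F = filterᵇ (λ S → memᵇ (relabel σ S) F) (allSubsets n)

module _ (σ : Fin n → Fin n) (σ-involutive : Algebra.Involutive _≡_ σ) where

  relabel-involutive : (S : Subset n) → relabel σ (relabel σ S) ≡ S
  relabel-involutive S = lookup-ext λ i →
    trans (lookup-relabel σ (relabel σ S) i) (trans (lookup-relabel σ S (σ i)) (cong (lookup S) (σ-involutive i)))

  relabel-injective : {S T : Subset n} → relabel σ S ≡ relabel σ T → S ≡ T
  relabel-injective {S} {T} e = trans (sym (relabel-involutive S)) (trans (cong (relabel σ) e) (relabel-involutive T))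

  eqᵇ-relabel : (S T : Subset n) → eqᵇ (relabel σ S) (relabel σ T) ≡ eqᵇ S T
  eqᵇ-relabel S T = ≡true-ext
    (λ e → subst (λ U → eqᵇ S U ≡ true) (relabel-injective (eqᵇ⇒≡ {S = relabel σ S} {relabel σ T} e)) (eqᵇ-refl S))
    (λ e → subst (λ U → eqᵇ (relabel σ S) (relabel σ U) ≡ true) (eqᵇ⇒≡ {S = S} {T} e) (eqᵇ-refl (relabel σ S)))

  isEmptyᵇ-relabel : (S : Subset n) → isEmptyᵇ (relabel σ S) ≡ isEmptyᵇ S
  isEmptyᵇ-relabel S = begin
    isEmptyᵇ (relabel σ S)          ≡⟨ isEmptyᵇ≡eqᵇ-⊥ (relabel σ S) ⟩
    eqᵇ (relabel σ S) ⊥             ≡⟨ cong (eqᵇ (relabel σ S)) (sym (relabel-replicate σ false)) ⟩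
    eqᵇ (relabel σ S) (relabel σ ⊥) ≡⟨ eqᵇ-relabel S ⊥ ⟩
    eqᵇ S ⊥                         ≡⟨ sym (isEmptyᵇ≡eqᵇ-⊥ S) ⟩
    isEmptyᵇ S                      ∎
    where open ≡-Reasoning

  eqᵇ-relabel-⊤ : (S : Subset n) → eqᵇ (relabel σ S) ⊤ ≡ eqᵇ S ⊤
  eqᵇ-relabel-⊤ S = trans (cong (eqᵇ (relabel σ S)) (sym (relabel-replicate σ true))) (eqᵇ-relabel S ⊤)

  subᵇ-relabel : (S T : Subset n) → subᵇ (relabel σ S) (relabel σ T) ≡ subᵇ S T
  subᵇ-relabel S T =
    trans (cong (λ U → eqᵇ U (relabel σ S)) (sym (relabel-zipWith σ _∧_ S T))) (eqᵇ-relabel (S ∩ T) S)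

  splitCompatibleᵇ-relabel : (S T : Subset n) → splitCompatibleᵇ (relabel σ S) (relabel σ T) ≡ splitCompatibleᵇ S T
  splitCompatibleᵇ-relabel S T =
    cong₂ _∨_ (trans (cong isEmptyᵇ (sym (relabel-zipWith σ _∧_ S T))) (isEmptyᵇ-relabel (S ∩ T)))
      (cong₂ _∨_ (subᵇ-relabel S T) (cong₂ _∨_ (subᵇ-relabel T S)
        (trans (cong (λ U → eqᵇ U ⊤) (sym (relabel-zipWith σ _∨_ S T))) (eqᵇ-relabel-⊤ (S ∪ T)))))

  relabel-⁅⁆ : (i : Fin n) → relabel σ ⁅ i ⁆ ≡ ⁅ σ i ⁆
  relabel-⁅⁆ i = lookup-ext λ j → trans (lookup-relabel σ ⁅ i ⁆ j) (≡true-ext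
    (λ e → subst (λ k → lookup ⁅ σ i ⁆ k ≡ true) (trans (cong σ (lookup-⁅⁆⇒≡ i (σ j) e)) (σ-involutive j))
                 (lookup-⁅⁆-self (σ i)))
    (λ e → subst (λ k → lookup ⁅ i ⁆ k ≡ true) (trans (sym (σ-involutive i)) (cong σ (lookup-⁅⁆⇒≡ (σ i) j e)))
                 (lookup-⁅⁆-self i)))

  memᵇ-relabelSplits : (F : List (Subset n)) (S : Subset n) → memᵇ S (relabelSplits σ F) ≡ memᵇ (relabel σ S) F
  memᵇ-relabelSplits F S = memᵇ-filterᵇ _ (allSubsets n) (∈-allSubsets S)

  all-relabelSplits : (p : Subset n → Bool) (F : List (Subset n)) → all p (relabelSplits σ F) ≡ all (p ∘ relabel σ) F
  all-relabelSplits p F = all-image p (relabel σ) F (relabelSplits σ F) onto into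
    where
    onto : ∀ {S} → S ∈ relabelSplits σ F → ∃ λ T → T ∈ F × S ≡ relabel σ T
    onto {S} S∈ =
      relabel σ S , memᵇ⇒∈ F (proj₂ (∈-filterᵇ⁻ _ (allSubsets n) S∈)) , sym (relabel-involutive S)
    into : ∀ {T} → T ∈ F → relabel σ T ∈ relabelSplits σ F
    into {T} T∈F = ∈-filterᵇ⁺ _ (∈-allSubsets _)
      (subst (λ U → memᵇ U F ≡ true) (sym (relabel-involutive T)) (∈⇒memᵇ T∈F))

  any-relabelSplits : (p : Subset n → Bool) (F : List (Subset n)) → any p (relabelSplits σ F) ≡ any (p ∘ relabel σ) F
  any-relabelSplits p F = trans (any≡not-all-not p (relabelSplits σ F))
    (trans (cong not (all-relabelSplits (not ∘ p) F)) (sym (any≡not-all-not _ F)))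

  all-allFins-involution : (q : Fin n → Bool) → all q (allFins n) ≡ all (q ∘ σ) (allFins n)
  all-allFins-involution q =
    all-image q σ (allFins n) (allFins n) (λ {i} _ → σ i , ∈-allFins _ , sym (σ-involutive i)) (λ _ → ∈-allFins _)

  isSplitSystem-relabelSplits : (F : List (Subset n)) → isSplitSystem (relabelSplits σ F) ≡ isSplitSystem F
  isSplitSystem-relabelSplits F = cong₂ _∧_ complement-closed (cong₂ _∧_ proper (cong₂ _∧_ pendant compatible))
    where
    complement-closed : all (λ A → memᵇ (∁ A) (relabelSplits σ F)) (relabelSplits σ F) ≡
                        all (λ A → memᵇ (∁ A) F) F
    complement-closed = trans (all-relabelSplits _ F) (all-cong F λ A → trans (memᵇ-relabelSplits F (∁ (relabel σ A)))
      (cong (λ B → memᵇ B F) (trans (relabel-∁ σ (relabel σ A)) (cong ∁ (relabel-involutive A)))))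
    proper : all (λ A → not (isEmptyᵇ A) ∧ not (eqᵇ A ⊤)) (relabelSplits σ F) ≡
             all (λ A → not (isEmptyᵇ A) ∧ not (eqᵇ A ⊤)) F
    proper = trans (all-relabelSplits _ F)
      (all-cong F λ A → cong₂ (λ a b → not a ∧ not b) (isEmptyᵇ-relabel A) (eqᵇ-relabel-⊤ A))
    pendant : all (λ i → memᵇ ⁅ i ⁆ (relabelSplits σ F)) (allFins n) ≡ all (λ i → memᵇ ⁅ i ⁆ F) (allFins n)
    pendant = trans
      (all-cong (allFins n) λ i → trans (memᵇ-relabelSplits F ⁅ i ⁆) (cong (λ B → memᵇ B F) (relabel-⁅⁆ i)))
      (sym (all-allFins-involution (λ i → memᵇ ⁅ i ⁆ F)))
    compatible : all (λ A → all (splitCompatibleᵇ A) (relabelSplits σ F)) (relabelSplits σ F) ≡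
                 all (λ A → all (splitCompatibleᵇ A) F) F
    compatible = trans (all-relabelSplits _ F)
      (all-cong F λ A → trans (all-relabelSplits _ F) (all-cong F (splitCompatibleᵇ-relabel A)))

  restrictedSides-relabelSplits : (F : List (Subset n)) (Y : Subset n) →
    restrictedSides (relabelSplits σ F) (relabel σ Y) ≡ restrictedSides F Y
  restrictedSides-relabelSplits F Y =
    trans (countᵇ-allSubsets-involution _ (relabel σ) relabel-involutive) (countᵇ-cong (allSubsets n) side)
    where
    side : ∀ S →
      (not (isEmptyᵇ (relabel σ S)) ∧ not (eqᵇ (relabel σ S) (relabel σ Y)) ∧
        any (λ A → eqᵇ (A ∩ relabel σ Y) (relabel σ S)) (relabelSplits σ F)) ≡
      (not (isEmptyᵇ S) ∧ not (eqᵇ S Y) ∧ any (λ A → eqᵇ (A ∩ Y) S) F)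
    side S = cong₂ (λ a b → not a ∧ b) (isEmptyᵇ-relabel S) (cong₂ (λ a b → not a ∧ b) (eqᵇ-relabel S Y)
      (trans (any-relabelSplits _ F) (any-cong F λ A →
        trans (cong (λ B → eqᵇ B (relabel σ S)) (sym (relabel-zipWith σ _∧_ A Y))) (eqᵇ-relabel (A ∩ Y) S))))

  relabelSplits-involutive : (F : List (Subset n)) → F ∈ sublists (allSubsets n) →
    relabelSplits σ (relabelSplits σ F) ≡ F
  relabelSplits-involutive F F∈ =
    trans (filterᵇ-cong (allSubsets n) (λ {S} _ →
             trans (memᵇ-relabelSplits F (relabel σ S)) (cong (λ T → memᵇ T F) (relabel-involutive S))))
          (filterᵇ-memᵇ-sublist (allSubsets n) (allSubsets-unique n) F∈)

  countᵇ-splitSystems-relabel : (k : ℕ) (Y : Subset n) →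
    countᵇ (λ F → isSplitSystem F ∧ (restrictedSides F Y ≡ᵇ k)) (sublists (allSubsets n)) ≡
    countᵇ (λ F → isSplitSystem F ∧ (restrictedSides F (relabel σ Y) ≡ᵇ k)) (sublists (allSubsets n))
  countᵇ-splitSystems-relabel k Y = countᵇ-bijection _ _ trees! trees! before after (relabelSplits σ) (relabelSplits σ)
    (λ {F} F∈ beforeF → relabelled∈ F , trans (after-relabel F) beforeF , relabelSplits-involutive F F∈)
    (λ {F} F∈ afterF → relabelled∈ F , trans (before-relabel F) afterF , relabelSplits-involutive F F∈)
    where
    relabelled∈ : ∀ F → relabelSplits σ F ∈ sublists (allSubsets n)
    relabelled∈ F = filterᵇ∈sublists (λ S → memᵇ (relabel σ S) F) (allSubsets n)
    trees! : Unique (sublists (allSubsets n))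
    trees! = sublists-unique (allSubsets n) (allSubsets-unique n)
    before : List (Subset n) → Bool
    before F = isSplitSystem F ∧ (restrictedSides F Y ≡ᵇ k)
    after : List (Subset n) → Bool
    after F = isSplitSystem F ∧ (restrictedSides F (relabel σ Y) ≡ᵇ k)
    after-relabel : ∀ F → after (relabelSplits σ F) ≡ before F
    after-relabel F = cong₂ _∧_ (isSplitSystem-relabelSplits F) (cong (_≡ᵇ k) (restrictedSides-relabelSplits F Y))
    before-relabel : ∀ F → before (relabelSplits σ F) ≡ after F
    before-relabel F = cong₂ _∧_ (isSplitSystem-relabelSplits F) (cong (_≡ᵇ k)
      (trans (cong (restrictedSides (relabelSplits σ F)) (sym (relabel-involutive Y)))
             (restrictedSides-relabelSplits F (relabel σ Y))))

RelabellingInvariant : (Subset n → A) → Set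
RelabellingInvariant {n} c = ∀ σ → Algebra.Involutive _≡_ σ → ∀ S → c (relabel σ S) ≡ c S

lift₀ : (Fin n → Fin n) → Fin (suc n) → Fin (suc n)
lift₀ σ zero = zero
lift₀ σ (suc i) = suc (σ i)

lift₀-involutive : (σ : Fin n → Fin n) → Algebra.Involutive _≡_ σ → Algebra.Involutive _≡_ (lift₀ σ)
lift₀-involutive σ σ-involutive zero = refl
lift₀-involutive σ σ-involutive (suc i) = cong suc (σ-involutive i)

-- relabel (lift₀ σ) (b ∷ S) reduces to b ∷ relabel σ S
RelabellingInvariant-∷ : {c : Subset (suc n) → A} → RelabellingInvariant c →
  (b : Bool) → RelabellingInvariant (c ∘ (b ∷_))
RelabellingInvariant-∷ c-inv b σ σ-involutive S = c-inv (lift₀ σ) (lift₀-involutive σ σ-involutive) (b ∷ S)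

swap₀ : Fin n → Fin (suc n) → Fin (suc n)
swap₀ j zero = suc j
swap₀ j (suc i) with i ≟ j
... | yes _ = zero
... | no  _ = suc i

swap₀-involutive : (j : Fin n) → Algebra.Involutive _≡_ (swap₀ j)
swap₀-involutive j zero with j ≟ j
... | yes _   = refl
... | no  j≢j = ⊥-elim (j≢j refl)
swap₀-involutive j (suc i) with i ≟ j
... | yes refl = refl
... | no  i≢j with i ≟ j
...   | yes i≡j = ⊥-elim (i≢j i≡j)
...   | no  _   = refl

∃-lookup≡true : (S : Subset n) {k : ℕ} → ∣ S ∣ ≡ suc k → ∃ λ j → lookup S j ≡ true
∃-lookup≡true (true ∷ S) _ = zero , refl
∃-lookup≡true (false ∷ S) e with ∃-lookup≡true S e
... | j , Sj = suc j , Sj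

suc-∣∣-remove : (S T : Subset n) (j : Fin n) → lookup S j ≡ true → lookup T j ≡ false →
  (∀ i → ¬ i ≡ j → lookup T i ≡ lookup S i) → suc ∣ T ∣ ≡ ∣ S ∣
suc-∣∣-remove (true ∷ S) (false ∷ T) zero refl refl T≗S =
  cong (suc ∘ ∣_∣) (lookup-ext {S = T} {S} λ i → T≗S (suc i) (λ ()))
suc-∣∣-remove (s ∷ S) (t ∷ T) (suc j) Sj Tj T≗S with T≗S zero (λ ())
suc-∣∣-remove (true ∷ S)  (true ∷ T)  (suc j) Sj Tj T≗S | refl =
  cong suc (suc-∣∣-remove S T j Sj Tj (λ i i≢j → T≗S (suc i) (i≢j ∘ Fin.suc-injective)))
suc-∣∣-remove (false ∷ S) (false ∷ T) (suc j) Sj Tj T≗S | refl =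
  suc-∣∣-remove S T j Sj Tj (λ i i≢j → T≗S (suc i) (i≢j ∘ Fin.suc-injective))

relabellingInvariant-≡ : (c : Subset n → A) → RelabellingInvariant c →
  (S T : Subset n) → ∣ S ∣ ≡ ∣ T ∣ → c S ≡ c T
relabellingInvariant-≡-∷ : (c : Subset (suc n) → A) → RelabellingInvariant c →
  (S T : Subset n) → suc ∣ S ∣ ≡ ∣ T ∣ → c (true ∷ S) ≡ c (false ∷ T)

relabellingInvariant-≡ c c-inv [] [] _ = refl
relabellingInvariant-≡ c c-inv (true ∷ S) (true ∷ T) e =
  relabellingInvariant-≡ (c ∘ (true ∷_)) (RelabellingInvariant-∷ c-inv true) S T (suc-injective e)
relabellingInvariant-≡ c c-inv (false ∷ S) (false ∷ T) e =
  relabellingInvariant-≡ (c ∘ (false ∷_)) (RelabellingInvariant-∷ c-inv false) S T e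
relabellingInvariant-≡ c c-inv (true ∷ S) (false ∷ T) e = relabellingInvariant-≡-∷ c c-inv S T e
relabellingInvariant-≡ c c-inv (false ∷ S) (true ∷ T) e = sym (relabellingInvariant-≡-∷ c c-inv T S (sym e))

-- Swapping leaf 0 with a leaf j ∈ T moves a leaf of false ∷ T into position 0, leaving T′ with ∣ T′ ∣ = ∣ S ∣.
relabellingInvariant-≡-∷ {n} c c-inv S T e with ∃-lookup≡true T (sym e)
... | j , Tj = begin
  c (true ∷ S)
    ≡⟨ relabellingInvariant-≡ (c ∘ (true ∷_)) (RelabellingInvariant-∷ c-inv true) S T′ ∣S∣≡∣T′∣ ⟩
  c (true ∷ T′)                      ≡⟨ cong (λ b → c (b ∷ T′)) Tj ⟨
  c (relabel (swap₀ j) (false ∷ T))  ≡⟨ c-inv (swap₀ j) (swap₀-involutive j) (false ∷ T) ⟩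
  c (false ∷ T)                      ∎
  where
  open ≡-Reasoning
  T′ : Subset n
  T′ = tabulate (lookup (false ∷ T) ∘ swap₀ j ∘ suc)
  lookup-T′ : ∀ i → lookup T′ i ≡ lookup (false ∷ T) (swap₀ j (suc i))
  lookup-T′ = lookup∘tabulate (lookup (false ∷ T) ∘ swap₀ j ∘ suc)
  T′j : lookup T′ j ≡ false
  T′j = trans (lookup-T′ j) (swapped j)
    where
    swapped : ∀ i → lookup (false ∷ T) (swap₀ i (suc i)) ≡ false
    swapped i with i ≟ i
    ... | yes _   = refl
    ... | no  i≢i = ⊥-elim (i≢i refl)
  T′≗T : ∀ i → ¬ i ≡ j → lookup T′ i ≡ lookup T i
  T′≗T i i≢j = trans (lookup-T′ i) unswapped
    where
    unswapped : lookup (false ∷ T) (swap₀ j (suc i)) ≡ lookup T i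
    unswapped with i ≟ j
    ... | yes i≡j = ⊥-elim (i≢j i≡j)
    ... | no  _   = refl
  ∣S∣≡∣T′∣ : ∣ S ∣ ≡ ∣ T′ ∣
  ∣S∣≡∣T′∣ = suc-injective (trans e (sym (suc-∣∣-remove T T′ j Tj T′j T′≗T)))

≡ᵇ-double : (k m : ℕ) → (k + k ≡ᵇ m + m) ≡ (k ≡ᵇ m)
≡ᵇ-double zero zero = refl
≡ᵇ-double zero (suc m) = refl
≡ᵇ-double (suc k) zero = refl
≡ᵇ-double (suc k) (suc m) = trans (cong₂ _≡ᵇ_ (+-suc k k) (+-suc m m)) (≡ᵇ-double k m)

resolvedSides≡resolvedClusters+resolvedClusters : (k : ℕ) → 2 * (2 * suc k ∸ 3) ≡ (2 * k ∸ 1) + (2 * k ∸ 1)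
resolvedSides≡resolvedClusters+resolvedClusters k =
  trans (cong (λ m → 2 * (m ∸ 3)) (*-suc 2 k)) (cong ((2 * k ∸ 1) +_) (+-identityʳ (2 * k ∸ 1)))

unrootedResolvedᵇ-toSplits : (X : Subset n) (H : List (Subset n)) →
  unrootedResolvedᵇ (true ∷ X) (toSplits H) ≡ rootedResolvedᵇ X H
unrootedResolvedᵇ-toSplits X H =
  trans (cong₂ _≡ᵇ_ (restrictedSides-toSplits H X) (resolvedSides≡resolvedClusters+resolvedClusters ∣ X ∣))
        (≡ᵇ-double (restrictedClusters H X) (2 * ∣ X ∣ ∸ 1))

r′≡r-∷ : (n : ℕ) (X : Subset n) → r′ n X ≡ r (suc n) (true ∷ X)
r′≡r-∷ n X = cong₂ ratio resolved trees
  where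
  rootedTrees : List (List (Subset n))
  rootedTrees = sublists (allSubsets n)
  unrootedTrees : List (List (Subset (suc n)))
  unrootedTrees = sublists (allSubsets (suc n))
  open ≡-Reasoning
  resolved : countᵇ (rootedResolvedᵇ X) (RP n) ≡ countᵇ (unrootedResolvedᵇ (true ∷ X)) (P (suc n))
  resolved = begin
    countᵇ (rootedResolvedᵇ X) (RP n)
      ≡⟨ countᵇ-filterᵇ (rootedResolvedᵇ X) isHierarchy rootedTrees ⟩
    countᵇ (λ H → isHierarchy H ∧ rootedResolvedᵇ X H) rootedTrees
      ≡⟨ countᵇ-rooted≡countᵇ-unrooted (rootedResolvedᵇ X) (unrootedResolvedᵇ (true ∷ X))
                                        (unrootedResolvedᵇ-toSplits X) ⟩
    countᵇ (λ F → isSplitSystem F ∧ unrootedResolvedᵇ (true ∷ X) F) unrootedTrees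
      ≡⟨ countᵇ-filterᵇ (unrootedResolvedᵇ (true ∷ X)) isSplitSystem unrootedTrees ⟨
    countᵇ (unrootedResolvedᵇ (true ∷ X)) (P (suc n)) ∎
  trees : length (RP n) ≡ length (P (suc n))
  trees = begin
    countᵇ isHierarchy rootedTrees
      ≡⟨ countᵇ-cong rootedTrees (λ H → ∧-identityʳ (isHierarchy H)) ⟨
    countᵇ (λ H → isHierarchy H ∧ true) rootedTrees
      ≡⟨ countᵇ-rooted≡countᵇ-unrooted {n} (λ _ → true) (λ _ → true) (λ _ → refl) ⟩
    countᵇ (λ F → isSplitSystem F ∧ true) unrootedTrees
      ≡⟨ countᵇ-cong unrootedTrees (λ F → ∧-identityʳ (isSplitSystem F)) ⟩
    countᵇ isSplitSystem unrootedTrees ∎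

r-≡ : (m : ℕ) (Y Y′ : Subset m) → ∣ Y ∣ ≡ ∣ Y′ ∣ → r m Y ≡ r m Y′
r-≡ m Y Y′ ∣Y∣≡∣Y′∣ = cong (λ k → ratio k (length (P m))) (begin
  countᵇ (unrootedResolvedᵇ Y) (P m)  ≡⟨ countᵇ-filterᵇ (unrootedResolvedᵇ Y) isSplitSystem trees ⟩
  resolvedWith (sides ∣ Y ∣) Y        ≡⟨ relabellingInvariant-≡ (resolvedWith (sides ∣ Y ∣)) invariant Y Y′ ∣Y∣≡∣Y′∣ ⟩
  resolvedWith (sides ∣ Y ∣) Y′       ≡⟨ cong (λ s → resolvedWith (sides s) Y′) ∣Y∣≡∣Y′∣ ⟩
  resolvedWith (sides ∣ Y′ ∣) Y′      ≡⟨ countᵇ-filterᵇ (unrootedResolvedᵇ Y′) isSplitSystem trees ⟨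
  countᵇ (unrootedResolvedᵇ Y′) (P m) ∎)
  where
  open ≡-Reasoning
  trees : List (List (Subset m))
  trees = sublists (allSubsets m)
  sides : ℕ → ℕ
  sides s = 2 * (2 * s ∸ 3)
  resolvedWith : ℕ → Subset m → ℕ
  resolvedWith k Z = countᵇ (λ F → isSplitSystem F ∧ (restrictedSides F Z ≡ᵇ k)) trees
  invariant : RelabellingInvariant (resolvedWith (sides ∣ Y ∣))
  invariant σ σ-involutive Z = sym (countᵇ-splitSystems-relabel σ σ-involutive (sides ∣ Y ∣) Z)

lemma5 : (n : ℕ) → 3 ≤ n →
    (X : Subset n) → ∣ X ∣ ≡ 3 →
    (Y : Subset (suc n)) → ∣ Y ∣ ≡ 4 →
    (r′ n X ≡ r (suc n) Y) × (u′ n X ≡ u (suc n) Y)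
lemma5 n _ X ∣X∣≡3 Y ∣Y∣≡4 = r′≡r , cong (1ℚ -_) r′≡r
  where
  r′≡r : r′ n X ≡ r (suc n) Y
  r′≡r = trans (r′≡r-∷ n X) (r-≡ (suc n) (true ∷ X) Y (trans (cong suc ∣X∣≡3) (sym ∣Y∣≡4)))
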